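{- Let $r\ge1$, $n\ge0$ and $m$ be integers with $m>r+2$. Let $M^{(m,n,r)}$ be the $m\times m$ matrix with entries $M_{i,j}=F^{(r)}_{n+i+j-2}$, $1\le i,j\le m$. Then $\det\big(M^{(m,n,r)}\big)=0$.
   Context: Let $(F_k)_{k\ge0}$ be the Fibonacci numbers, $F_0=0$, $F_1=1$, $F_{k+2}=F_{k+1}+F_k$. The hyperfibonacci numbers are defined for $k\ge 0$ by $F^{(0)}_k=F_k$ and, for $r\ge1$, $F^{(r)}_k=\sum_{j=0}^{k}F^{(r-1)}_j$ (so $F^{(r)}_0=0$, $F^{(r)}_1=1$). -}

module Defs where

open import Data.Nat using (ℕ; zero; suc)
import Data.Nat as ℕ
open import Data.Integer using (ℤ; +_; _+_; _*_; -_)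
open import Data.Fin using (Fin; zero; suc; punchIn; toℕ)

fib : ℕ → ℕ
fib zero = 0
fib (suc zero) = 1
fib (suc (suc k)) = fib (suc k) ℕ.+ fib k

sumTo : (ℕ → ℕ) → ℕ → ℕ
sumTo f zero = f zero
sumTo f (suc k) = sumTo f k ℕ.+ f (suc k)

hyperfib : ℕ → ℕ → ℕ
hyperfib zero k = fib k
hyperfib (suc r) k = sumTo (hyperfib r) k

Matrix : ℕ → Set
Matrix n = Fin n → Fin n → ℤ

minor : ∀ {n} → Matrix (suc n) → Fin (suc n) → Matrix n
minor A j r c = A (suc r) (punchIn j c)

sign : ℕ → ℤ → ℤ
sign zero x = x
sign (suc k) x = - sign k x

sumFin : ∀ {n} → (Fin n → ℤ) → ℤ
sumFin {zero} f = + 0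
sumFin {suc n} f = f zero + sumFin (λ i → f (suc i))

det : ∀ {n} → Matrix n → ℤ
det {zero} A = + 1
det {suc n} A = sumFin (λ j → sign (toℕ j) (A zero j * det (minor A j)))

-- the Hankel matrix M^{(m,n,r)}, 0-indexed: M i j = F^(r)_{n+i+j}
-- (equals F^(r)_{n+i'+j'-2} with 1-based indices i' = i+1, j' = j+1)
hyperfibMatrix : (m n r : ℕ) → Matrix m
hyperfibMatrix m n r i j = + hyperfib r (n ℕ.+ toℕ i ℕ.+ toℕ j)

-- Summation inverts the difference operator E − 1 (E the shift), so F⁽ʳ⁾ is annihilated by
-- (E − 1)ʳ (E² − E − 1). This polynomial has degree r + 2 and constant term ±1, hence every
-- F⁽ʳ⁾ₖ is an integer combination of the next r + 2 terms. In the Hankel matrix this makes the first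
-- row a combination of rows 1, …, r + 2, which exist since m > r + 2. The Laplace expansion
-- defining det is linear in the first row and vanishes when the first row repeats another one
-- (by antisymmetry of the expansion along the first two rows), so the determinant is 0.
module Submission where

open import Defs
open import Data.Nat.Base as ℕ using (ℕ; zero; suc; s≤s)
open import Data.Integer.Base using (ℤ; +_; 0ℤ; 1ℤ)
import Data.Integer.Properties as ℤ
open import Data.Fin.Base using (Fin; zero; suc; punchIn; punchOut; toℕ; inject≤)
open import Algebra.Properties.Semiring.Sum ℤ.+-*-semiring
  using (sum-syntax; sum-cong-≗; sum-remove; sum-replicate-zero; ∑-comm; *-distribˡ-sum; *-distribʳ-sum)
open import Function.Base using (_∘_)
open import Relation.Binary.PropositionalEquality.Core using (_≡_; refl; sym; trans; cong; cong₂)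
open import Relation.Binary.PropositionalEquality.Properties using (module ≡-Reasoning)

module Determinant where
  open import Data.Integer.Base using (_+_; _*_; -_; +[1+_]; -[1+_])
  open import Data.Integer.Tactic.RingSolver using (solve-∀)
  open import Data.Fin.Patterns using (0F; 1F)
  open import Data.Fin.Properties using (_≟_; punchInᵢ≢i; punchOut-cong; punchOut-punchIn)
  open import Data.Vec.Functional using (_∷_)
  open import Relation.Binary.PropositionalEquality.Core using (_≢_)
  open import Relation.Nullary.Decidable.Core using (yes; no)
  open import Relation.Nullary.Negation.Core using (contradiction)
  open ≡-Reasoning

  private variable n : ℕ

  x≡-x⇒x≡0 : ∀ {x} → x ≡ - x → x ≡ 0ℤ
  x≡-x⇒x≡0 {+ zero} _ = refl
  x≡-x⇒x≡0 {+[1+ _ ]} ()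
  x≡-x⇒x≡0 { -[1+ _ ]} ()

  sumFin≡∑ : (f : Fin n → ℤ) → sumFin f ≡ ∑[ i < n ] f i
  sumFin≡∑ {zero} f = refl
  sumFin≡∑ {suc n} f = cong (λ s → f zero + s) (sumFin≡∑ (f ∘ suc))

  neg-distrib-∑ : (f : Fin n → ℤ) → - (∑[ i < n ] f i) ≡ ∑[ i < n ] (- f i)
  neg-distrib-∑ {zero} f = refl
  neg-distrib-∑ {suc n} f =
    trans (ℤ.neg-distrib-+ (f zero) _) (cong (λ s → - f zero + s) (neg-distrib-∑ (f ∘ suc)))

  sign-0 : ∀ k → sign k 0ℤ ≡ 0ℤ
  sign-0 zero = refl
  sign-0 (suc k) = cong -_ (sign-0 k)

  sign-neg : ∀ k x → sign k (- x) ≡ - sign k x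
  sign-neg zero x = refl
  sign-neg (suc k) x = cong -_ (sign-neg k x)

  sign-distribʳ-* : ∀ k x y → sign k (x * y) ≡ x * sign k y
  sign-distribʳ-* zero x y = refl
  sign-distribʳ-* (suc k) x y = trans (cong -_ (sign-distribʳ-* k x y)) (ℤ.neg-distribʳ-* x _)

  sign-distrib-∑ : ∀ k (f : Fin n → ℤ) → sign k (∑[ i < n ] f i) ≡ ∑[ i < n ] sign k (f i)
  sign-distrib-∑ zero f = refl
  sign-distrib-∑ (suc k) f = trans (cong -_ (sign-distrib-∑ k f)) (neg-distrib-∑ (λ i → sign k (f i)))

  det-expand : (A : Matrix (suc n)) → det A ≡ ∑[ j < suc n ] sign (toℕ j) (A zero j * det (minor A j))
  det-expand A = sumFin≡∑ (λ j → sign (toℕ j) (A zero j * det (minor A j)))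

  det-cong : {A B : Matrix n} → (∀ i j → A i j ≡ B i j) → det A ≡ det B
  det-cong {zero} A≗B = refl
  det-cong {suc n} {A} {B} A≗B = begin
    det A                                                    ≡⟨ det-expand A ⟩
    ∑[ j < suc n ] sign (toℕ j) (A zero j * det (minor A j))  ≡⟨ sum-cong-≗ entry≡ ⟩
    ∑[ j < suc n ] sign (toℕ j) (B zero j * det (minor B j))  ≡⟨ det-expand B ⟨
    det B                                                    ∎
    where
    entry≡ : ∀ j → sign (toℕ j) (A zero j * det (minor A j)) ≡ sign (toℕ j) (B zero j * det (minor B j))
    entry≡ j = cong (sign (toℕ j))
      (cong₂ _*_ (A≗B zero j) (det-cong (λ r c → A≗B (suc r) (punchIn j c))))

  det-minors-zero : (A : Matrix (suc n)) → (∀ j → det (minor A j) ≡ 0ℤ) → det A ≡ 0ℤ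
  det-minors-zero {n} A minors≡0 = begin
    det A                                                    ≡⟨ det-expand A ⟩
    ∑[ j < suc n ] sign (toℕ j) (A zero j * det (minor A j))  ≡⟨ sum-cong-≗ entry≡0 ⟩
    ∑[ j < suc n ] 0ℤ                                         ≡⟨ sum-replicate-zero (suc n) ⟩
    0ℤ                                                        ∎
    where
    entry≡0 : ∀ j → sign (toℕ j) (A zero j * det (minor A j)) ≡ 0ℤ
    entry≡0 j rewrite minors≡0 j | ℤ.*-zeroʳ (A zero j) = sign-0 (toℕ j)

  punchIn-punchIn-comm : {j l : Fin (suc (suc n))} (j≢l : j ≢ l) (l≢j : l ≢ j) (c : Fin n) →
                         punchIn j (punchIn (punchOut j≢l) c) ≡ punchIn l (punchIn (punchOut l≢j) c)
  punchIn-punchIn-comm {j = zero}  {zero}  j≢l l≢j c = contradiction refl j≢l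
  punchIn-punchIn-comm {j = zero}  {suc l} j≢l l≢j c = refl
  punchIn-punchIn-comm {j = suc j} {zero}  j≢l l≢j c = refl
  punchIn-punchIn-comm {suc n} {suc j} {suc l} j≢l l≢j zero = refl
  punchIn-punchIn-comm {suc n} {suc j} {suc l} j≢l l≢j (suc c) =
    cong suc (punchIn-punchIn-comm (j≢l ∘ cong suc) (l≢j ∘ cong suc) c)

  -- Of j and l, the larger drops by one when the smaller is punched out, so the exponents differ by one.
  sign-punchOut-swap : {j l : Fin (suc (suc n))} (j≢l : j ≢ l) (l≢j : l ≢ j) (x : ℤ) →
    sign (toℕ j) (sign (toℕ (punchOut j≢l)) x) ≡ - sign (toℕ l) (sign (toℕ (punchOut l≢j)) x)
  sign-punchOut-swap {j = zero}  {zero}  j≢l l≢j x = contradiction refl j≢l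
  sign-punchOut-swap {j = zero}  {suc l} j≢l l≢j x = sym (ℤ.neg-involutive _)
  sign-punchOut-swap {j = suc j} {zero}  j≢l l≢j x = refl
  sign-punchOut-swap {zero} {suc zero} {suc zero} j≢l l≢j x = contradiction refl j≢l
  sign-punchOut-swap {suc n} {suc j} {suc l} j≢l l≢j x = begin
    - sign (toℕ j) (- sign (toℕ j′) x)
      ≡⟨ cong -_ (sign-neg (toℕ j) _) ⟩
    - - sign (toℕ j) (sign (toℕ j′) x)
      ≡⟨ cong (-_ ∘ -_) (sign-punchOut-swap (j≢l ∘ cong suc) (l≢j ∘ cong suc) x) ⟩
    - - - sign (toℕ l) (sign (toℕ l′) x)
      ≡⟨ cong (-_ ∘ -_) (sign-neg (toℕ l) _) ⟨
    - - sign (toℕ l) (- sign (toℕ l′) x)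
      ∎
    where
    j′ = punchOut (j≢l ∘ cong suc)
    l′ = punchOut (l≢j ∘ cong suc)

  minor₂ : (Fin n → Fin (suc (suc n)) → ℤ) → Fin (suc (suc n)) → Fin (suc n) → ℤ
  minor₂ R j k = det (λ r c → R r (punchIn j (punchIn k c)))

  -- The coefficient of a j * b l in det (a ∷ b ∷ R), expanded along its first two rows.
  cofactor₂ : (Fin n → Fin (suc (suc n)) → ℤ) → Fin (suc (suc n)) → Fin (suc (suc n)) → ℤ
  cofactor₂ R j l with j ≟ l
  ... | yes _   = 0ℤ
  ... | no j≢l = sign (toℕ j) (sign (toℕ (punchOut j≢l)) (minor₂ R j (punchOut j≢l)))

  cofactor₂-antisym : ∀ R (j l : Fin (suc (suc n))) → cofactor₂ R j l ≡ - cofactor₂ R l j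
  cofactor₂-antisym R j l with j ≟ l | l ≟ j
  ... | yes _   | yes _   = refl
  ... | yes j≡l | no l≢j = contradiction (sym j≡l) l≢j
  ... | no j≢l | yes l≡j = contradiction (sym l≡j) j≢l
  ... | no j≢l | no l≢j = trans
    (cong (sign (toℕ j) ∘ sign (toℕ (punchOut j≢l)))
          (det-cong (λ r c → cong (R r) (punchIn-punchIn-comm j≢l l≢j c))))
    (sign-punchOut-swap j≢l l≢j _)

  cofactor₂-diag : ∀ R (j : Fin (suc (suc n))) → cofactor₂ R j j ≡ 0ℤ
  cofactor₂-diag R j with j ≟ j
  ... | yes _   = refl
  ... | no j≢j = contradiction refl j≢j

  cofactor₂-punchIn : ∀ R (j : Fin (suc (suc n))) k →
                      cofactor₂ R j (punchIn j k) ≡ sign (toℕ j) (sign (toℕ k) (minor₂ R j k))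
  cofactor₂-punchIn R j k with j ≟ punchIn j k
  ... | yes j≡jₖ = contradiction (sym j≡jₖ) (punchInᵢ≢i j k)
  ... | no j≢jₖ = cong (λ k′ → sign (toℕ j) (sign (toℕ k′) (minor₂ R j k′)))
                        (trans (punchOut-cong j refl) (punchOut-punchIn j))

  det-expand₂ : (a b : Fin (suc (suc n)) → ℤ) (R : Fin n → Fin (suc (suc n)) → ℤ) →
    det (a ∷ b ∷ R) ≡ ∑[ j < suc (suc n) ] (a j * ∑[ l < suc (suc n) ] (b l * cofactor₂ R j l))
  det-expand₂ {n} a b R = trans (det-expand (a ∷ b ∷ R)) (sum-cong-≗ row₁-expansion)
    where
    row₁-expansion : ∀ j → sign (toℕ j) (a j * det (minor (a ∷ b ∷ R) j))
                           ≡ a j * ∑[ l < suc (suc n) ] (b l * cofactor₂ R j l)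
    row₁-expansion j = begin
      sign (toℕ j) (a j * det (minor (a ∷ b ∷ R) j))
        ≡⟨ cong (λ d → sign (toℕ j) (a j * d)) (det-expand (minor (a ∷ b ∷ R) j)) ⟩
      sign (toℕ j) (a j * ∑[ k < suc n ] term k)
        ≡⟨ sign-distribʳ-* (toℕ j) (a j) (∑[ k < suc n ] term k) ⟩
      a j * sign (toℕ j) (∑[ k < suc n ] term k)
        ≡⟨ cong (a j *_) (sign-distrib-∑ (toℕ j) term) ⟩
      a j * ∑[ k < suc n ] sign (toℕ j) (term k)
        ≡⟨ cong (a j *_) (sum-cong-≗ signs-inward) ⟩
      a j * ∑[ k < suc n ] (bⱼ k * cofactor₂ R j (punchIn j k))
        ≡⟨ cong (a j *_) diagonal-term-vanishes ⟨
      a j * ∑[ l < suc (suc n) ] (b l * cofactor₂ R j l)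
        ∎
      where
      bⱼ : Fin (suc n) → ℤ
      bⱼ k = b (punchIn j k)
      term : Fin (suc n) → ℤ
      term k = sign (toℕ k) (bⱼ k * minor₂ R j k)
      signs-inward : ∀ k → sign (toℕ j) (term k) ≡ bⱼ k * cofactor₂ R j (punchIn j k)
      signs-inward k = begin
        sign (toℕ j) (sign (toℕ k) (bⱼ k * minor₂ R j k))
          ≡⟨ cong (sign (toℕ j)) (sign-distribʳ-* (toℕ k) (bⱼ k) (minor₂ R j k)) ⟩
        sign (toℕ j) (bⱼ k * sign (toℕ k) (minor₂ R j k))
          ≡⟨ sign-distribʳ-* (toℕ j) (bⱼ k) (sign (toℕ k) (minor₂ R j k)) ⟩
        bⱼ k * sign (toℕ j) (sign (toℕ k) (minor₂ R j k))
          ≡⟨ cong (bⱼ k *_) (cofactor₂-punchIn R j k) ⟨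
        bⱼ k * cofactor₂ R j (punchIn j k)
          ∎
      diagonal-term-vanishes : ∑[ l < suc (suc n) ] (b l * cofactor₂ R j l)
                               ≡ ∑[ k < suc n ] (bⱼ k * cofactor₂ R j (punchIn j k))
      diagonal-term-vanishes
        rewrite sum-remove {i = j} (λ l → b l * cofactor₂ R j l)
              | cofactor₂-diag R j | ℤ.*-zeroʳ (b j) = ℤ.+-identityˡ _

  bilinear-antisym : ∀ {m} (w : Fin m → Fin m → ℤ) → (∀ j l → w j l ≡ - w l j) → (a b : Fin m → ℤ) →
    ∑[ j < m ] (b j * ∑[ l < m ] (a l * w j l)) ≡ - ∑[ j < m ] (a j * ∑[ l < m ] (b l * w j l))
  bilinear-antisym {m} w w-antisym a b = begin
    ∑[ j < m ] (b j * ∑[ l < m ] (a l * w j l))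
      ≡⟨ sum-cong-≗ (λ j → *-distribˡ-sum (b j) (λ l → a l * w j l)) ⟩
    ∑[ j < m ] ∑[ l < m ] (b j * (a l * w j l))
      ≡⟨ ∑-comm (λ j l → b j * (a l * w j l)) ⟩
    ∑[ l < m ] ∑[ j < m ] (b j * (a l * w j l))
      ≡⟨ sum-cong-≗ (λ l → sum-cong-≗ (swap-factors l)) ⟩
    ∑[ l < m ] ∑[ j < m ] (- (a l * (b j * w l j)))
      ≡⟨ sum-cong-≗ (λ l → neg-distrib-∑ (λ j → a l * (b j * w l j))) ⟨
    ∑[ l < m ] (- ∑[ j < m ] (a l * (b j * w l j)))
      ≡⟨ sum-cong-≗ (λ l → cong -_ (*-distribˡ-sum (a l) (λ j → b j * w l j))) ⟨
    ∑[ l < m ] (- (a l * ∑[ j < m ] (b j * w l j)))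
      ≡⟨ neg-distrib-∑ (λ l → a l * ∑[ j < m ] (b j * w l j)) ⟨
    - ∑[ l < m ] (a l * ∑[ j < m ] (b j * w l j))
      ∎
    where
    swap-factors : ∀ l j → b j * (a l * w j l) ≡ - (a l * (b j * w l j))
    swap-factors l j rewrite w-antisym j l = commute (b j) (a l) (w l j)
      where
      commute : ∀ x y z → x * (y * - z) ≡ - (y * (x * z))
      commute = solve-∀

  det-swap₀₁ : (a b : Fin (suc (suc n)) → ℤ) (R : Fin n → Fin (suc (suc n)) → ℤ) →
               det (b ∷ a ∷ R) ≡ - det (a ∷ b ∷ R)
  det-swap₀₁ a b R = begin
    det (b ∷ a ∷ R)                                          ≡⟨ det-expand₂ b a R ⟩
    ∑[ j < _ ] (b j * ∑[ l < _ ] (a l * cofactor₂ R j l))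
      ≡⟨ bilinear-antisym (cofactor₂ R) (cofactor₂-antisym R) a b ⟩
    - ∑[ j < _ ] (a j * ∑[ l < _ ] (b l * cofactor₂ R j l))  ≡⟨ cong -_ (det-expand₂ a b R) ⟨
    - det (a ∷ b ∷ R)                                        ∎

  det-equal-rows : (A : Matrix (suc n)) (i : Fin n) → (∀ c → A zero c ≡ A (suc i) c) → det A ≡ 0ℤ
  det-equal-rows {suc n} A zero row₀≡row₁ = x≡-x⇒x≡0 (begin
    det A                  ≡⟨ det-cong rows-swapped ⟩
    det (A 1F ∷ A 0F ∷ R)  ≡⟨ det-swap₀₁ (A 0F) (A 1F) R ⟩
    - det A                ∎)
    where
    R = λ r → A (suc (suc r))
    rows-swapped : ∀ r c → A r c ≡ (A 1F ∷ A 0F ∷ R) r c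
    rows-swapped zero c = row₀≡row₁ c
    rows-swapped (suc zero) c = sym (row₀≡row₁ c)
    rows-swapped (suc (suc r)) c = refl
  -- After swapping rows 0 and 1, every minor along the new first row has two equal rows.
  det-equal-rows {suc n} A (suc i) row₀≡row = begin
    det A                      ≡⟨ ℤ.neg-involutive (det A) ⟨
    - - det A                  ≡⟨ cong -_ (det-swap₀₁ (A 0F) (A 1F) R) ⟨
    - det (A 1F ∷ A 0F ∷ R)    ≡⟨ cong -_ (det-minors-zero (A 1F ∷ A 0F ∷ R) minors-singular) ⟩
    - 0ℤ                       ∎
    where
    R = λ r → A (suc (suc r))
    minors-singular : ∀ j → det (minor (A 1F ∷ A 0F ∷ R) j) ≡ 0ℤ
    minors-singular j = det-equal-rows (minor (A 1F ∷ A 0F ∷ R) j) i (row₀≡row ∘ punchIn j)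

  det-linear₀ : ∀ {d} (c : Fin d → ℤ) (V : Fin d → Fin (suc n) → ℤ) (R : Fin n → Fin (suc n) → ℤ) →
    det ((λ j → ∑[ t < d ] (c t * V t j)) ∷ R) ≡ ∑[ t < d ] (c t * det (V t ∷ R))
  det-linear₀ {n} {d} c V R = begin
    det ((λ j → ∑[ t < d ] (c t * V t j)) ∷ R)
      ≡⟨ det-expand ((λ j → ∑[ t < d ] (c t * V t j)) ∷ R) ⟩
    ∑[ j < suc n ] sign (toℕ j) (∑[ t < d ] (c t * V t j) * M j)
      ≡⟨ sum-cong-≗ distribute ⟩
    ∑[ j < suc n ] ∑[ t < d ] (c t * sign (toℕ j) (V t j * M j))
      ≡⟨ ∑-comm (λ j t → c t * sign (toℕ j) (V t j * M j)) ⟩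
    ∑[ t < d ] ∑[ j < suc n ] (c t * sign (toℕ j) (V t j * M j))
      ≡⟨ sum-cong-≗ (λ t → *-distribˡ-sum (c t) (λ j → sign (toℕ j) (V t j * M j))) ⟨
    ∑[ t < d ] (c t * ∑[ j < suc n ] sign (toℕ j) (V t j * M j))
      ≡⟨ sum-cong-≗ (λ t → cong (c t *_) (det-expand (V t ∷ R))) ⟨
    ∑[ t < d ] (c t * det (V t ∷ R))
      ∎
    where
    M : Fin (suc n) → ℤ
    M j = det (λ r k → R r (punchIn j k))
    distribute : ∀ j → sign (toℕ j) (∑[ t < d ] (c t * V t j) * M j)
                       ≡ ∑[ t < d ] (c t * sign (toℕ j) (V t j * M j))
    distribute j = begin
      sign (toℕ j) (∑[ t < d ] (c t * V t j) * M j)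
        ≡⟨ cong (sign (toℕ j)) (*-distribʳ-sum (M j) (λ t → c t * V t j)) ⟩
      sign (toℕ j) (∑[ t < d ] (c t * V t j * M j))
        ≡⟨ sign-distrib-∑ (toℕ j) (λ t → c t * V t j * M j) ⟩
      ∑[ t < d ] sign (toℕ j) (c t * V t j * M j)
        ≡⟨ sum-cong-≗ (λ t → cong (sign (toℕ j)) (ℤ.*-assoc (c t) (V t j) (M j))) ⟩
      ∑[ t < d ] sign (toℕ j) (c t * (V t j * M j))
        ≡⟨ sum-cong-≗ (λ t → sign-distribʳ-* (toℕ j) (c t) (V t j * M j)) ⟩
      ∑[ t < d ] (c t * sign (toℕ j) (V t j * M j))
        ∎

  det-row₀-in-span : ∀ {d} (A : Matrix (suc n)) (ι : Fin d → Fin n) (c : Fin d → ℤ) →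
    (∀ j → A zero j ≡ ∑[ t < d ] (c t * A (suc (ι t)) j)) → det A ≡ 0ℤ
  det-row₀-in-span {n} {d} A ι c row₀≡ = begin
    det A                                          ≡⟨ det-cong row₀-replaced ⟩
    det (row₀ ∷ R)                                 ≡⟨ det-linear₀ c (R ∘ ι) R ⟩
    ∑[ t < d ] (c t * det (R (ι t) ∷ R))           ≡⟨ sum-cong-≗ vanishes ⟩
    ∑[ t < d ] 0ℤ                                  ≡⟨ sum-replicate-zero d ⟩
    0ℤ                                             ∎
    where
    R = λ i → A (suc i)
    row₀ = λ j → ∑[ t < d ] (c t * R (ι t) j)
    row₀-replaced : ∀ i j → A i j ≡ (row₀ ∷ R) i j
    row₀-replaced zero j = row₀≡ j
    row₀-replaced (suc i) j = refl
    vanishes : ∀ t → c t * det (R (ι t) ∷ R) ≡ 0ℤ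
    vanishes t rewrite det-equal-rows (R (ι t) ∷ R) (ι t) (λ _ → refl) = ℤ.*-zeroʳ (c t)

module LinearRecurrence where
  open import Data.Integer.Base using (_+_; _*_; _-_; -_)
  open import Data.Integer.Tactic.RingSolver using (solve-∀)
  open import Data.Nat.Properties using (+-suc)
  open import Data.Vec.Base using (Vec; []; _∷_; head; lookup)

  private variable d : ℕ

  -- For a coefficient vector p, ⟦ p ⟧ g = ∑ₜ pₜ g(t) is (p(E) g)(0), where E is the shift operator.
  ⟦_⟧ : Vec ℤ d → (ℕ → ℤ) → ℤ
  ⟦_⟧ {d} p g = ∑[ t < d ] (lookup p t * g (toℕ t))

  Annihilates : Vec ℤ d → (ℕ → ℤ) → Set
  Annihilates p g = ∀ k → ⟦ p ⟧ (λ i → g (i ℕ.+ k)) ≡ 0ℤ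

  Δ : (ℕ → ℤ) → ℕ → ℤ
  Δ g i = g (suc i) - g i

  infixr 5 _+[X-1]*_
  _+[X-1]*_ : ℤ → Vec ℤ d → Vec ℤ (suc d)
  a +[X-1]* []      = a ∷ []
  a +[X-1]* (c ∷ p) = (a - c) ∷ (c +[X-1]* p)

  head-+[X-1]* : ∀ a (p : Vec ℤ (suc d)) → head (a +[X-1]* p) ≡ a - head p
  head-+[X-1]* a (c ∷ p) = refl

  ⟦⟧-cong : (p : Vec ℤ d) {g h : ℕ → ℤ} → (∀ i → g i ≡ h i) → ⟦ p ⟧ g ≡ ⟦ p ⟧ h
  ⟦⟧-cong p g≗h = sum-cong-≗ (λ t → cong (lookup p t *_) (g≗h (toℕ t)))

  ⟦⟧-+[X-1]* : ∀ a (p : Vec ℤ d) g → ⟦ a +[X-1]* p ⟧ g ≡ a * g 0 + ⟦ p ⟧ (Δ g)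
  ⟦⟧-+[X-1]* a []      g = refl
  ⟦⟧-+[X-1]* a (c ∷ p) g = trans
    (cong (λ s → (a - c) * g 0 + s) (⟦⟧-+[X-1]* c p (g ∘ suc)))
    (regroup a c (g 0) (g 1) (⟦ p ⟧ (Δ g ∘ suc)))
    where
    regroup : ∀ a c x y s → (a - c) * x + (c * y + s) ≡ a * x + (c * (y - x) + s)
    regroup = solve-∀

  annihilates-Δ : (p : Vec ℤ d) (g : ℕ → ℤ) → Annihilates p (Δ g) → Annihilates (0ℤ +[X-1]* p) g
  annihilates-Δ p g ann k = trans (⟦⟧-+[X-1]* 0ℤ p (λ i → g (i ℕ.+ k))) (cong (λ s → 0ℤ + s) (ann k))

  annihilates-suc : (p : Vec ℤ d) (g : ℕ → ℤ) → Annihilates p g → Annihilates p (g ∘ suc)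
  annihilates-suc p g ann k = trans (⟦⟧-cong p (λ i → cong g (sym (+-suc i k)))) (ann (suc k))

  backwardCoefficient : Vec ℤ (suc d) → Fin d → ℤ
  backwardCoefficient p t = - head p * lookup p (suc t)

  backward-recurrence : (p : Vec ℤ (suc d)) (g : ℕ → ℤ) → head p * head p ≡ 1ℤ → Annihilates p g →
    ∀ k → g k ≡ ∑[ t < d ] (backwardCoefficient p t * g (suc (toℕ t) ℕ.+ k))
  backward-recurrence {d} (c ∷ p) g c²≡1 ann k = begin
    g k
      ≡⟨ solve-for-g (ann k) ⟩
    - c * ⟦ p ⟧ gₖ₊₁
      ≡⟨ *-distribˡ-sum (- c) (λ t → lookup p t * gₖ₊₁ (toℕ t)) ⟩
    ∑[ t < d ] (- c * (lookup p t * gₖ₊₁ (toℕ t)))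
      ≡⟨ sum-cong-≗ (λ t → ℤ.*-assoc (- c) (lookup p t) (gₖ₊₁ (toℕ t))) ⟨
    ∑[ t < d ] (- c * lookup p t * gₖ₊₁ (toℕ t))
      ∎
    where
    open ≡-Reasoning
    gₖ₊₁ = λ i → g (suc i ℕ.+ k)
    solve-for-g : c * g k + ⟦ p ⟧ gₖ₊₁ ≡ 0ℤ → g k ≡ - c * ⟦ p ⟧ gₖ₊₁
    solve-for-g eq = begin
      g k                                  ≡⟨ ℤ.*-identityˡ (g k) ⟨
      1ℤ * g k                             ≡⟨ cong (λ u → u * g k) c²≡1 ⟨
      c * c * g k                          ≡⟨ split c (g k) S ⟩
      c * (c * g k + S) + - c * S          ≡⟨ cong (λ v → c * v + - c * S) eq ⟩
      c * 0ℤ + - c * S                     ≡⟨ drop c S ⟩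
      - c * S                              ∎
      where
      S = ⟦ p ⟧ gₖ₊₁
      split : ∀ c x s → c * c * x ≡ c * (c * x + s) + - c * s
      split = solve-∀
      drop : ∀ c s → c * 0ℤ + - c * s ≡ - c * s
      drop = solve-∀

module Hyperfibonacci where
  open import Data.Integer.Base using (_+_; _*_; _-_; -1ℤ)
  open import Data.Integer.Tactic.RingSolver using (solve-∀)
  import Data.Nat.Tactic.RingSolver as ℕ-Solver
  open import Data.Fin.Properties using (toℕ-inject≤)
  open import Data.Vec.Base using (Vec; []; _∷_; head)
  open LinearRecurrence

  hyperfibℤ : ℕ → ℕ → ℤ
  hyperfibℤ r k = + hyperfib r k

  -- The coefficients of (X − 1)ʳ (X² − X − 1).
  hyperfibAnnihilator : (r : ℕ) → Vec ℤ (3 ℕ.+ r)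
  hyperfibAnnihilator zero    = -1ℤ ∷ -1ℤ ∷ 1ℤ ∷ []
  hyperfibAnnihilator (suc r) = 0ℤ +[X-1]* hyperfibAnnihilator r

  hyperfibAnnihilator-unit : ∀ r → head (hyperfibAnnihilator r) * head (hyperfibAnnihilator r) ≡ 1ℤ
  hyperfibAnnihilator-unit zero    = refl
  hyperfibAnnihilator-unit (suc r) rewrite head-+[X-1]* 0ℤ (hyperfibAnnihilator r) =
    trans (negate² (head (hyperfibAnnihilator r))) (hyperfibAnnihilator-unit r)
    where
    negate² : ∀ c → (0ℤ - c) * (0ℤ - c) ≡ c * c
    negate² = solve-∀

  fib-annihilated : Annihilates (-1ℤ ∷ -1ℤ ∷ 1ℤ ∷ []) (hyperfibℤ 0)
  fib-annihilated k rewrite ℤ.pos-+ (fib (suc k)) (fib k) = cancel (+ fib k) (+ fib (suc k))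
    where
    cancel : ∀ x y → -1ℤ * x + (-1ℤ * y + (1ℤ * (y + x) + 0ℤ)) ≡ 0ℤ
    cancel = solve-∀

  Δ-hyperfib : ∀ r i → Δ (hyperfibℤ (suc r)) i ≡ hyperfibℤ r (suc i)
  Δ-hyperfib r i rewrite ℤ.pos-+ (hyperfib (suc r) i) (hyperfib r (suc i)) =
    cancel (hyperfibℤ (suc r) i) (hyperfibℤ r (suc i))
    where
    cancel : ∀ x y → x + y - x ≡ y
    cancel = solve-∀

  hyperfib-annihilated : ∀ r → Annihilates (hyperfibAnnihilator r) (hyperfibℤ r)
  hyperfib-annihilated zero    = fib-annihilated
  hyperfib-annihilated (suc r) = annihilates-Δ p (hyperfibℤ (suc r)) λ k →
    trans (⟦⟧-cong p (λ i → Δ-hyperfib r (i ℕ.+ k)))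
          (annihilates-suc p (hyperfibℤ r) (hyperfib-annihilated r) k)
    where p = hyperfibAnnihilator r

  hyperfibMatrix-row₀ : ∀ {m} n r (2+r≤m : 2 ℕ.+ r ℕ.≤ m) (j : Fin (suc m)) →
    hyperfibMatrix (suc m) n r zero j
      ≡ ∑[ t < 2 ℕ.+ r ] (backwardCoefficient (hyperfibAnnihilator r) t
                           * hyperfibMatrix (suc m) n r (suc (inject≤ t 2+r≤m)) j)
  hyperfibMatrix-row₀ n r 2+r≤m j =
    trans (backward-recurrence p (hyperfibℤ r) (hyperfibAnnihilator-unit r) (hyperfib-annihilated r) _)
          (sum-cong-≗ (λ t → cong (λ i → backwardCoefficient p t * hyperfibℤ r i) (index t)))
    where
    p = hyperfibAnnihilator r
    hankel : ∀ t n j → suc t ℕ.+ (n ℕ.+ 0 ℕ.+ j) ≡ n ℕ.+ suc t ℕ.+ j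
    hankel = ℕ-Solver.solve-∀
    index : ∀ t → suc (toℕ t) ℕ.+ (n ℕ.+ 0 ℕ.+ toℕ j)
                  ≡ n ℕ.+ suc (toℕ (inject≤ t 2+r≤m)) ℕ.+ toℕ j
    index t rewrite toℕ-inject≤ t 2+r≤m = hankel (toℕ t) n (toℕ j)

open Determinant using (det-row₀-in-span)
open LinearRecurrence using (backwardCoefficient)
open Hyperfibonacci using (hyperfibAnnihilator; hyperfibMatrix-row₀)
open import Data.Nat.Base using (_≤_; _>_; _+_)
open import Data.Nat.Properties using (+-comm; ≤-trans; ≤-reflexive)

mainTheorem7 : (r n m : ℕ) → 1 ≤ r → m > r + 2 →
    det (hyperfibMatrix m n r) ≡ + 0
mainTheorem7 r n zero    _ ()
mainTheorem7 r n (suc m) _ (s≤s r+2≤m) =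
  det-row₀-in-span (hyperfibMatrix (suc m) n r) (λ t → inject≤ t 2+r≤m)
    (backwardCoefficient (hyperfibAnnihilator r)) (hyperfibMatrix-row₀ n r 2+r≤m)
  where
  2+r≤m : 2 + r ≤ m
  2+r≤m = ≤-trans (≤-reflexive (+-comm 2 r)) r+2≤m
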